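{- For every nonzero $\alpha\in\mathbb{Z}[\omega]$, $N(\sigma(\alpha))\ge N(\alpha)$.
   Context: $\omega=e^{2\pi i/3}$, $N(a+b\omega)=a^2-ab+b^2$. Positive primes: $\mathbb{P}^+=\{a+b\omega: a>b\ge 0\}\cap\{\text{primes of }\mathbb{Z}[\omega]\}$. For nonzero $\alpha=\varepsilon\prod\pi_j^{e_j}$ ($\varepsilon$ a unit, distinct $\pi_j\in\mathbb{P}^+$), $\sigma(\alpha)=\prod\frac{\pi_j^{e_j+1}-1}{\pi_j-1}$. -}

module Defs where

open import Data.Integer using (ℤ; +_; _+_; _-_; _*_; -_; _<_; _≤_)
open import Data.Nat using (ℕ; zero; suc)
import Data.Nat as ℕ
open import Data.Product using (Σ; ∃; _×_; _,_; proj₁; proj₂)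
open import Data.Sum using (_⊎_)
open import Data.List using (List; []; _∷_; map)
open import Data.List.Relation.Unary.All using (All)
open import Data.List.Relation.Unary.Unique.Propositional using (Unique)
open import Relation.Binary.PropositionalEquality using (_≡_)
open import Relation.Nullary using (¬_)

-- Eisenstein integers: ⟨ a , b ⟩ represents a + b ω, ω = e^{2πi/3}, ω² = -1 - ω.
record Eis : Set where
  constructor ⟨_,_⟩
  field
    re : ℤ
    im : ℤ
open Eis public

0E 1E : Eis
0E = ⟨ + 0 , + 0 ⟩
1E = ⟨ + 1 , + 0 ⟩

infixl 6 _+E_ _-E_
infixl 7 _*E_

_+E_ : Eis → Eis → Eis
⟨ a , b ⟩ +E ⟨ c , d ⟩ = ⟨ a + c , b + d ⟩

_-E_ : Eis → Eis → Eis
⟨ a , b ⟩ -E ⟨ c , d ⟩ = ⟨ a - c , b - d ⟩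

-- (a + bω)(c + dω) = (ac - bd) + (ad + bc - bd) ω
_*E_ : Eis → Eis → Eis
⟨ a , b ⟩ *E ⟨ c , d ⟩ = ⟨ a * c - b * d , a * d + b * c - b * d ⟩

_^E_ : Eis → ℕ → Eis
x ^E zero = 1E
x ^E suc n = x *E (x ^E n)

N : Eis → ℤ
N ⟨ a , b ⟩ = a * a - a * b + b * b

_∣E_ : Eis → Eis → Set
x ∣E y = ∃ λ k → y ≡ x *E k

IsUnit : Eis → Set
IsUnit u = ∃ λ v → u *E v ≡ 1E

IsPrimeE : Eis → Set
IsPrimeE p = ¬ (p ≡ 0E) × ¬ IsUnit p ×
             (∀ x y → p ∣E (x *E y) → (p ∣E x) ⊎ (p ∣E y))

IsPositivePrime : Eis → Set
IsPositivePrime p = IsPrimeE p × (im p < re p) × (+ 0 ≤ im p)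

prodE : List Eis → Eis
prodE [] = 1E
prodE (x ∷ xs) = x *E prodE xs

-- geometric sum 1 + π + … + π^e  (= (π^{e+1} - 1)/(π - 1), exact quotient in ℤ[ω])
geomE : Eis → ℕ → Eis
geomE p zero = 1E
geomE p (suc e) = (p ^E suc e) +E geomE p e

IsFactorization : Eis → Eis → List (Eis × ℕ) → Set
IsFactorization α ε fs =
  IsUnit ε ×
  All (λ pe → IsPositivePrime (proj₁ pe) × (1 ℕ.≤ proj₂ pe)) fs ×
  Unique (map proj₁ fs) ×
  (α ≡ ε *E prodE (map (λ pe → proj₁ pe ^E proj₂ pe) fs))

σFrom : List (Eis × ℕ) → Eis
σFrom fs = prodE (map (λ pe → geomE (proj₁ pe) (proj₂ pe)) fs)

-- N is multiplicative and units have norm 1, so it suffices to show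
-- N(π^e) ≤ N(1 + π + … + π^e) for each positive prime π = a + bω, whose trace
-- T = 2a − b is at least 3.  Multiplying by N(π − 1) and using
-- (π − 1)(1 + … + π^e) = π^(e+1) − 1 together with N(z − 1) = N z − tr z + 1,
-- the claim becomes tr(π^(e+1)) ≤ (T − 1) N(π)^e + 1, which follows from
-- tr(z)² ≤ 4 N(z) because T − 1 ≥ 2.
module Submission where

open import Defs
open import Data.Integer using (_≤_)
open import Data.Nat using (ℕ)
open import Data.Product using (_×_)
open import Data.List using (List)
open import Relation.Binary.PropositionalEquality using (_≡_)
open import Relation.Nullary using (¬_)

open import Data.Integer as ℤ using (ℤ; +_; _+_; _-_; -_; _*_; _<_; -[1+_]; +[1+_]; +≤+; +<+; 0ℤ)
open import Data.Integer.Properties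
open import Data.Integer.Tactic.RingSolver using (solve-∀)
open import Data.Nat as ℕ using (zero; suc)
import Data.Nat.Properties as ℕ
open import Data.Product using (_,_; proj₁; proj₂)
open import Data.List using ([]; _∷_; map)
open import Data.List.Relation.Unary.All as All using (All; []; _∷_)
open import Relation.Binary.PropositionalEquality
  using (refl; sym; trans; cong; cong₂; subst; module ≡-Reasoning)
open import Relation.Nullary using (yes; no)
open import Data.Empty using (⊥-elim)

0≤i*i : ∀ i → 0ℤ ≤ i * i
0≤i*i (+ 0)    = +≤+ ℕ.z≤n
0≤i*i +[1+ n ] = +≤+ ℕ.z≤n
0≤i*i -[1+ n ] = +≤+ ℕ.z≤n

0≤i⇒0≤j⇒0≤i*j : ∀ {i j} → 0ℤ ≤ i → 0ℤ ≤ j → 0ℤ ≤ i * j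
0≤i⇒0≤j⇒0≤i*j {i} {j} 0≤i 0≤j =
  subst (_≤ i * j) (*-zeroˡ j) (*-monoʳ-≤-nonNeg j {{ℤ.nonNegative 0≤j}} 0≤i)

i+j≡k⇒i≤k : ∀ {i j k} → 0ℤ ≤ j → i + j ≡ k → i ≤ k
i+j≡k⇒i≤k {i} {j} 0≤j refl = i≤i+j i j {{ℤ.nonNegative 0≤j}}

*-mono-≤-nonNeg : ∀ {i j k l} → 0ℤ ≤ j → 0ℤ ≤ k → i ≤ j → k ≤ l → i * k ≤ j * l
*-mono-≤-nonNeg {i} {j} {k} {l} 0≤j 0≤k i≤j k≤l = ≤-trans
  (*-monoʳ-≤-nonNeg k {{ℤ.nonNegative 0≤k}} i≤j)
  (*-monoˡ-≤-nonNeg j {{ℤ.nonNegative 0≤j}} k≤l)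

i*i≤j*j⇒i≤j : ∀ {i j} → 0ℤ ≤ j → i * i ≤ j * j → i ≤ j
i*i≤j*j⇒i≤j {i} {j} 0≤j ii≤jj with i ≤? j
... | yes i≤j = i≤j
... | no  i≰j = ⊥-elim (<⇒≱ jj<ii ii≤jj)
  where
    j<i : j < i
    j<i = ≰⇒> i≰j

    jj<ii : j * j < i * i
    jj<ii = ≤-<-trans (*-monoˡ-≤-nonNeg j {{ℤ.nonNegative 0≤j}} (<⇒≤ j<i))
                      (*-monoʳ-<-pos i {{ℤ.positive (≤-<-trans 0≤j j<i)}} j<i)

-- The trace x + x̄ of x = a + bω, since ω + ω̄ = −1.
tr : Eis → ℤ
tr x = + 2 * re x - im x

N-*E : ∀ x y → N (x *E y) ≡ N x * N y
N-*E ⟨ a , b ⟩ ⟨ c , d ⟩ = identity a b c d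
  where
    identity : ∀ a b c d →
      (a * c - b * d) * (a * c - b * d) - (a * c - b * d) * (a * d + b * c - b * d)
        + (a * d + b * c - b * d) * (a * d + b * c - b * d)
      ≡ (a * a - a * b + b * b) * (c * c - c * d + d * d)
    identity = solve-∀

4N≡tr²+3im² : ∀ x → + 4 * N x ≡ tr x * tr x + + 3 * (im x * im x)
4N≡tr²+3im² ⟨ a , b ⟩ = identity a b
  where
    identity : ∀ a b → + 4 * (a * a - a * b + b * b) ≡ (+ 2 * a - b) * (+ 2 * a - b) + + 3 * (b * b)
    identity = solve-∀

N[x-1]≡N-tr+1 : ∀ x → N (x -E 1E) ≡ N x - tr x + + 1
N[x-1]≡N-tr+1 ⟨ a , b ⟩ = identity a b
  where
    identity : ∀ a b → (a - + 1) * (a - + 1) - (a - + 1) * (b - + 0) + (b - + 0) * (b - + 0)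
                       ≡ (a * a - a * b + b * b) - (+ 2 * a - b) + + 1
    identity = solve-∀

tr[x-1]≡tr-2 : ∀ x → tr (x -E 1E) ≡ tr x - + 2
tr[x-1]≡tr-2 ⟨ a , b ⟩ = identity a b
  where
    identity : ∀ a b → + 2 * (a - + 1) - (b - + 0) ≡ + 2 * a - b - + 2
    identity = solve-∀

tr²≤4N : ∀ x → tr x * tr x ≤ + 4 * N x
tr²≤4N x = i+j≡k⇒i≤k (0≤i⇒0≤j⇒0≤i*j {+ 3} (+≤+ ℕ.z≤n) (0≤i*i (im x))) (sym (4N≡tr²+3im² x))

N-nonNeg : ∀ x → 0ℤ ≤ N x
N-nonNeg x = *-cancelˡ-≤-pos 0ℤ (N x) (+ 4) (≤-trans (0≤i*i (tr x)) (tr²≤4N x))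

tr≤ : ∀ {x j} → 0ℤ ≤ j → + 4 * N x ≤ j * j → tr x ≤ j
tr≤ {x} 0≤j 4N≤jj = i*i≤j*j⇒i≤j 0≤j (≤-trans (tr²≤4N x) 4N≤jj)

1≤tr⇒1≤N : ∀ x → + 1 ≤ tr x → + 1 ≤ N x
1≤tr⇒1≤N x 1≤tr = i<j⇒suc[i]≤j (*-cancelˡ-<-nonNeg {0ℤ} {N x} (+ 4) (begin-strict
  0ℤ              <⟨ +<+ (ℕ.s≤s ℕ.z≤n) ⟩
  + 1             ≤⟨ *-mono-≤-nonNeg (≤-trans (+≤+ ℕ.z≤n) 1≤tr) (+≤+ ℕ.z≤n) 1≤tr 1≤tr ⟩
  tr x * tr x     ≤⟨ tr²≤4N x ⟩
  + 4 * N x       ∎))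
  where open ≤-Reasoning

1≤N⇒1≤N-^E : ∀ x → + 1 ≤ N x → ∀ e → + 1 ≤ N (x ^E e)
1≤N⇒1≤N-^E x 1≤N zero    = ≤-refl
1≤N⇒1≤N-^E x 1≤N (suc e) = begin
  + 1 * + 1        ≤⟨ *-mono-≤-nonNeg (≤-trans (+≤+ ℕ.z≤n) 1≤N) (+≤+ ℕ.z≤n) 1≤N (1≤N⇒1≤N-^E x 1≤N e) ⟩
  N x * N (x ^E e) ≡⟨ N-*E x (x ^E e) ⟨
  N (x ^E suc e)   ∎
  where open ≤-Reasoning

N-unit : ∀ {u} → IsUnit u → N u ≡ + 1
N-unit {u} (v , uv≡1) with N u | N-nonNeg u | trans (sym (N-*E u v)) (cong N uv≡1)
... | + n | _ | Nu*Nv≡1 =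
  cong +_ (ℕ.m*n≡1⇒m≡1 n ℤ.∣ N v ∣ (trans (sym (abs-* (+ n) (N v))) (cong ℤ.∣_∣ Nu*Nv≡1)))

*E-distribˡ-+E : ∀ x y z → x *E (y +E z) ≡ x *E y +E x *E z
*E-distribˡ-+E ⟨ a , b ⟩ ⟨ c , d ⟩ ⟨ e , f ⟩ = cong₂ ⟨_,_⟩ (re-identity a b c d e f) (im-identity a b c d e f)
  where
    re-identity : ∀ a b c d e f →
      a * (c + e) - b * (d + f) ≡ (a * c - b * d) + (a * e - b * f)
    re-identity = solve-∀
    im-identity : ∀ a b c d e f →
      a * (d + f) + b * (c + e) - b * (d + f) ≡ (a * d + b * c - b * d) + (a * f + b * e - b * f)
    im-identity = solve-∀

[x-1]y+[y-1]≡xy-1 : ∀ x y → (x -E 1E) *E y +E (y -E 1E) ≡ x *E y -E 1E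
[x-1]y+[y-1]≡xy-1 ⟨ a , b ⟩ ⟨ c , d ⟩ = cong₂ ⟨_,_⟩ (re-identity a b c d) (im-identity a b c d)
  where
    re-identity : ∀ a b c d →
      ((a - + 1) * c - (b - + 0) * d) + (c - + 1) ≡ (a * c - b * d) - + 1
    re-identity = solve-∀
    im-identity : ∀ a b c d →
      ((a - + 1) * d + (b - + 0) * c - (b - + 0) * d) + (d - + 0) ≡ (a * d + b * c - b * d) - + 0
    im-identity = solve-∀

[x-1]*1≡x¹-1 : ∀ x → (x -E 1E) *E 1E ≡ x ^E 1 -E 1E
[x-1]*1≡x¹-1 ⟨ a , b ⟩ = cong₂ ⟨_,_⟩ (re-identity a b) (im-identity a b)
  where
    re-identity : ∀ a b → (a - + 1) * + 1 - (b - + 0) * + 0 ≡ (a * + 1 - b * + 0) - + 1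
    re-identity = solve-∀
    im-identity : ∀ a b → (a - + 1) * + 0 + (b - + 0) * + 1 - (b - + 0) * + 0 ≡ (a * + 0 + b * + 1 - b * + 0) - + 0
    im-identity = solve-∀

geomE-telescope : ∀ x e → (x -E 1E) *E geomE x e ≡ x ^E suc e -E 1E
geomE-telescope x zero    = [x-1]*1≡x¹-1 x
geomE-telescope x (suc e) = begin
  (x -E 1E) *E (x ^E suc e +E geomE x e)              ≡⟨ *E-distribˡ-+E (x -E 1E) (x ^E suc e) (geomE x e) ⟩
  (x -E 1E) *E x ^E suc e +E (x -E 1E) *E geomE x e   ≡⟨ cong ((x -E 1E) *E x ^E suc e +E_) (geomE-telescope x e) ⟩
  (x -E 1E) *E x ^E suc e +E (x ^E suc e -E 1E)       ≡⟨ [x-1]y+[y-1]≡xy-1 x (x ^E suc e) ⟩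
  x ^E suc (suc e) -E 1E                              ∎
  where open ≡-Reasoning

module _ (x : Eis) (3≤T : + 3 ≤ tr x) where

  private
    T M u : ℤ
    T = tr x
    M = N x
    u = T - + 1

    2≤u : + 2 ≤ u
    2≤u = +-monoˡ-≤ (- + 1) 3≤T

    0≤u : 0ℤ ≤ u
    0≤u = ≤-trans (+≤+ ℕ.z≤n) 2≤u

    1≤M : + 1 ≤ M
    1≤M = 1≤tr⇒1≤N x (≤-trans (+≤+ (ℕ.s≤s ℕ.z≤n)) 3≤T)

  tr-^E-bound : ∀ e → tr (x ^E suc (suc e)) ≤ (tr x - + 1) * N (x ^E suc e)
  tr-^E-bound e = tr≤ {x ^E suc (suc e)} (0≤i⇒0≤j⇒0≤i*j 0≤u 0≤K) (begin
    + 4 * N (x *E x ^E suc e)  ≡⟨ cong (+ 4 *_) (N-*E x (x ^E suc e)) ⟩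
    + 4 * (M * K)              ≤⟨ *-monoˡ-≤-nonNeg (+ 4) (*-monoʳ-≤-nonNeg K {{ℤ.nonNegative 0≤K}} M≤K) ⟩
    + 4 * (K * K)              ≤⟨ *-monoʳ-≤-nonNeg (K * K) {{ℤ.nonNegative (0≤i*i K)}} 4≤u*u ⟩
    (u * u) * (K * K)          ≡⟨ identity u K ⟩
    (u * K) * (u * K)          ∎)
    where
      open ≤-Reasoning
      K = N (x ^E suc e)

      M≤K : M ≤ K
      M≤K = begin
        M                ≡⟨ *-identityʳ M ⟨
        M * + 1          ≤⟨ *-monoˡ-≤-nonNeg M {{ℤ.nonNegative (N-nonNeg x)}} (1≤N⇒1≤N-^E x 1≤M e) ⟩
        M * N (x ^E e)   ≡⟨ N-*E x (x ^E e) ⟨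
        K                ∎

      0≤K : 0ℤ ≤ K
      0≤K = N-nonNeg (x ^E suc e)

      4≤u*u : + 4 ≤ u * u
      4≤u*u = *-mono-≤-nonNeg 0≤u (+≤+ ℕ.z≤n) 2≤u 2≤u

      identity : ∀ u K → (u * u) * (K * K) ≡ (u * K) * (u * K)
      identity = solve-∀

  N-^E≤N-geomE : ∀ e → N (x ^E e) ≤ N (geomE x e)
  N-^E≤N-geomE zero    = ≤-refl
  N-^E≤N-geomE (suc e) = *-cancelˡ-≤-pos K (N S) m {{ℤ.positive 0<m}} (begin
    m * K             ≤⟨ i+j≡k⇒i≤k 0≤gap m*K+gap≡N[Z-1] ⟩
    N (Z -E 1E)       ≡⟨ cong N (geomE-telescope x (suc e)) ⟨
    N ((x -E 1E) *E S) ≡⟨ N-*E (x -E 1E) S ⟩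
    m * N S           ∎)
    where
      open ≤-Reasoning
      m K t : ℤ
      m = N (x -E 1E)
      K = N (x ^E suc e)
      t = tr (x ^E suc (suc e))
      S = geomE x (suc e)
      Z = x ^E suc (suc e)

      0<m : 0ℤ < m
      0<m = suc[i]≤j⇒i<j (1≤tr⇒1≤N (x -E 1E) (subst (+ 1 ≤_) (sym (tr[x-1]≡tr-2 x)) (+-monoˡ-≤ (- + 2) 3≤T)))

      gap : ℤ
      gap = (u * K - t) + + 1

      0≤gap : 0ℤ ≤ gap
      0≤gap = ≤-trans (i≤j⇒0≤j-i (tr-^E-bound e)) (i≤i+j (u * K - t) (+ 1))

      identity : ∀ M T K t → (M - T + + 1) * K + (((T - + 1) * K - t) + + 1) ≡ M * K - t + + 1
      identity = solve-∀

      m*K+gap≡N[Z-1] : m * K + gap ≡ N (Z -E 1E)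
      m*K+gap≡N[Z-1] = begin-equality
        m * K + gap                   ≡⟨ cong (λ n → n * K + gap) (N[x-1]≡N-tr+1 x) ⟩
        (M - T + + 1) * K + gap       ≡⟨ identity M T K t ⟩
        M * K - t + + 1               ≡⟨ cong (λ n → n - t + + 1) (N-*E x (x ^E suc e)) ⟨
        N Z - t + + 1                 ≡⟨ N[x-1]≡N-tr+1 Z ⟨
        N (Z -E 1E)                   ∎

positivePrime⇒3≤tr : ∀ {p} → IsPositivePrime p → + 3 ≤ tr p
positivePrime⇒3≤tr {⟨ a , b ⟩} ((_ , nonUnit , _) , b<a , 0≤b) =
  i+j≡k⇒i≤k (+-mono-≤ (i≤j⇒0≤j-i (i<j⇒suc[i]≤j b<a)) (i≤j⇒0≤j-i (2≤a a b b<a 0≤b nonUnit)))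
            (identity a b)
  where
    2≤a : ∀ a b → b < a → 0ℤ ≤ b → ¬ IsUnit ⟨ a , b ⟩ → + 2 ≤ a
    2≤a +[1+ suc n ] _        _           _ _  = +≤+ (ℕ.s≤s (ℕ.s≤s ℕ.z≤n))
    2≤a (+ 1)        (+ 0)    _           _ nu = ⊥-elim (nu (1E , refl))
    2≤a (+ 1)        +[1+ k ] (+<+ (ℕ.s≤s ())) _ _
    2≤a (+ 0)        (+ k)    (+<+ ())    _ _
    2≤a (+ a)        -[1+ k ] _           () _
    2≤a -[1+ n ]     (+ k)    ()          _ _
    2≤a -[1+ n ]     -[1+ k ] _           () _

    identity : ∀ a b → + 3 + ((a - (+ 1 + b)) + (a - + 2)) ≡ + 2 * a - b
    identity = solve-∀

N-prodE-mono : ∀ {A : Set} (f g : A → Eis) (as : List A) → All (λ a → N (f a) ≤ N (g a)) as →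
               N (prodE (map f as)) ≤ N (prodE (map g as))
N-prodE-mono f g []       []          = ≤-refl
N-prodE-mono f g (a ∷ as) (fa≤ga ∷ ≤s) = begin
  N (f a *E prodE (map f as))     ≡⟨ N-*E (f a) (prodE (map f as)) ⟩
  N (f a) * N (prodE (map f as))  ≤⟨ *-mono-≤-nonNeg (N-nonNeg (g a)) (N-nonNeg (prodE (map f as))) fa≤ga (N-prodE-mono f g as ≤s) ⟩
  N (g a) * N (prodE (map g as))  ≡⟨ N-*E (g a) (prodE (map g as)) ⟨
  N (g a *E prodE (map g as))     ∎
  where open ≤-Reasoning

mainTheorem5 : (α ε : Eis) (fs : List (Eis × ℕ)) → ¬ (α ≡ 0E) →
               IsFactorization α ε fs → N α ≤ N (σFrom fs)
mainTheorem5 α ε fs _ (unit , factors , _ , α≡επ) = begin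
  N α             ≡⟨ cong N α≡επ ⟩
  N (ε *E Π)      ≡⟨ N-*E ε Π ⟩
  N ε * N Π       ≡⟨ cong (_* N Π) (N-unit {ε} unit) ⟩
  + 1 * N Π       ≡⟨ *-identityˡ (N Π) ⟩
  N Π             ≤⟨ N-prodE-mono _ _ fs (All.map bound factors) ⟩
  N (σFrom fs)    ∎
  where
    open ≤-Reasoning
    Π : Eis
    Π = prodE (map (λ pe → proj₁ pe ^E proj₂ pe) fs)
    bound : ∀ {pe} → IsPositivePrime (proj₁ pe) × (1 ℕ.≤ proj₂ pe) →
            N (proj₁ pe ^E proj₂ pe) ≤ N (geomE (proj₁ pe) (proj₂ pe))
    bound {p , e} (prime , _) = N-^E≤N-geomE p (positivePrime⇒3≤tr prime) e
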